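{- Let $G$ be a graph and $A,B\subseteq V(G)$ with $|A|=|B|=:a$. If $$\sum_{A'\in\binom{A}{k}}|\mathrm{Obs}(G;A')|\leq\sum_{B'\in\binom{B}{k}}|\mathrm{Obs}(G;B')|$$ for all $k\in\{1,\dots,a\}$, then $\mathcal{E}(G;A,q)\preceq\mathcal{E}(G;B,q)$. Moreover, if the inequality is strict for some $k\in\{1,\dots,a\}$, then $\mathcal{E}(G;A,q)\prec\mathcal{E}(G;B,q)$.
   Context: Graphs are finite and simple; $N[X]$ is the closed neighborhood of $X$. Power domination process on a graph $H$ from $T\subseteq V(H)$: set $B_0:=N[T]$; then, while some $x\in B_0$ has exactly one vertex $y$ of $N[x]$ outside $B_0$, add $y$ to $B_0$. The final set is $\mathrm{Obs}(H;T)$ (with $\mathrm{Obs}(H;\emptyset)=\emptyset$). For $S\subseteq V(H)$, $\mathcal{E}(H;S,q)=\sum_{W\subseteq S}|\mathrm{Obs}(H;W)|\,q^{|S\setminus W|}(1-q)^{|W|}$. For polynomials $p_1,p_2$, $p_1\preceq p_2$ means $p_1(q)\leq p_2(q)$ for all $q\in[0,1]$, and $p_1\prec p_2$ means $p_1\preceq p_2$ and $p_1\neq p_2$. $\binom{A}{k}$ is the set of $k$-element subsets of $A$.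
   Formalization: The orders ⪯ and ≺ quantify only over rational values of q in [0,1], with the polynomials compared as functions on ℚ. -}

module Defs where

open import Data.Nat as ℕ using (ℕ; zero; suc)
open import Data.Bool using (Bool; true; false; _∧_; _∨_; not; if_then_else_)
open import Data.Fin using (Fin; _≟_)
open import Data.Fin.Subset using (Subset; inside; outside; ∣_∣)
open import Data.Vec using (Vec; []; _∷_; lookup; tabulate; _[_]≔_)
open import Data.List using (List; []; _∷_; map; _++_; filter; allFin; length)
open import Data.Bool.ListAction using (any)
open import Data.Nat.ListAction using (sum)
open import Data.Integer using (+_)
import Data.List as L
open import Data.Maybe using (Maybe; just; nothing)
open import Data.Rational as ℚ using (ℚ; 0ℚ; 1ℚ)
open import Relation.Nullary.Decidable using (⌊_⌋)
open import Relation.Binary.PropositionalEquality using (_≡_)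
open import Relation.Nullary using (¬_)
open import Data.Product using (_×_)

record Graph (n : ℕ) : Set where
  field
    adj    : Fin n → Fin n → Bool
    sym    : ∀ x y → adj x y ≡ adj y x
    irrefl : ∀ x → adj x x ≡ false
open Graph public

module _ {n : ℕ} (G : Graph n) where

  Nx : Fin n → Subset n
  Nx x = tabulate (λ y → ⌊ x ≟ y ⌋ ∨ adj G x y)

  NT : Subset n → Subset n
  NT T = tabulate (λ y → any (λ x → lookup T x ∧ lookup (Nx x) y) (allFin n))

  outsideNbrs : Subset n → Fin n → List (Fin n)
  outsideNbrs B x = filter (λ y → Data.Bool._≟_ (lookup (Nx x) y ∧ not (lookup B y)) true) (allFin n)

  forced : Subset n → Fin n → Maybe (Fin n)
  forced B x with lookup B x | outsideNbrs B x
  ... | true | y ∷ [] = just y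
  ... | _    | _      = nothing

  firstForced : Subset n → List (Fin n) → Maybe (Fin n)
  firstForced B []       = nothing
  firstForced B (x ∷ xs) with forced B x
  ... | just y  = just y
  ... | nothing = firstForced B xs

  step : Subset n → Subset n
  step B with firstForced B (allFin n)
  ... | just y  = B [ y ]≔ inside
  ... | nothing = B

  iterate : ℕ → Subset n → Subset n
  iterate zero    B = B
  iterate (suc k) B = iterate k (step B)

  -- Obs(G;T): each effective step adds a new vertex, so n steps reach the final set.
  Obs : Subset n → Subset n
  Obs T = iterate n (NT T)

subsetsOf : {n : ℕ} → Subset n → List (Subset n)
subsetsOf []              = [] ∷ []
subsetsOf (true ∷ p)  = map (outside ∷_) (subsetsOf p) ++ map (inside ∷_) (subsetsOf p)
subsetsOf (false ∷ p) = map (outside ∷_) (subsetsOf p)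

kSubsetsOf : {n : ℕ} → Subset n → ℕ → List (Subset n)
kSubsetsOf S k = filter (λ W → ∣ W ∣ ℕ.≟ k) (subsetsOf S)

obsSum : {n : ℕ} → Graph n → Subset n → ℕ → ℕ
obsSum G A k = sum (map (λ W → ∣ Obs G W ∣) (kSubsetsOf A k))

_^ℚ_ : ℚ → ℕ → ℚ
q ^ℚ zero  = 1ℚ
q ^ℚ suc m = q ℚ.* (q ^ℚ m)

sumℚ : List ℚ → ℚ
sumℚ = L.foldr ℚ._+_ 0ℚ

E : {n : ℕ} → Graph n → Subset n → ℚ → ℚ
E G S q = sumℚ (map (λ W → (+ ∣ Obs G W ∣ ℚ./ 1) ℚ.* (q ^ℚ (∣ S ∣ ℕ.∸ ∣ W ∣)) ℚ.* ((1ℚ ℚ.- q) ^ℚ ∣ W ∣)) (subsetsOf S))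

_⪯_ : (ℚ → ℚ) → (ℚ → ℚ) → Set
p₁ ⪯ p₂ = ∀ q → 0ℚ ℚ.≤ q → q ℚ.≤ 1ℚ → p₁ q ℚ.≤ p₂ q

-- p₁ ≺ p₂ : p₁ ⪯ p₂ and p₁ ≠ p₂ as polynomials (= as functions on ℚ)
_≺_ : (ℚ → ℚ) → (ℚ → ℚ) → Set
p₁ ≺ p₂ = (p₁ ⪯ p₂) × ¬ (∀ q → p₁ q ≡ p₂ q)

{-# OPTIONS --safe #-}
module Submission where

-- Grouping the subsets W ⊆ S by their size k gives
--   E(G;S,q) = Σ_{k ≤ |S|} obsSum(G,S,k) · q^(|S|-k) (1-q)^k,
-- a combination of the obsSum coefficients with weights that are nonnegative
-- on [0,1] and positive at q = ½. The k = 0 coefficient is |Obs(G;∅)| for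
-- both A and B, so the hypothesis compares every coefficient, and one strict
-- comparison already separates the two polynomials at ½.

open import Defs
open import Data.Nat using (ℕ; _≤_; _<_)
open import Data.Fin.Subset using (Subset; ∣_∣)
open import Data.Product using (_×_; ∃)
open import Relation.Binary.PropositionalEquality using (_≡_)

open import Algebra.Bundles using (CommutativeMonoid)
open import Data.Bool using (true; false)
open import Data.Vec using ([]; _∷_)
open import Data.Integer as ℤ using (+_)
import Data.Integer.Properties as ℤP
open import Data.Fin.Subset as FS using (inside; outside)
open import Data.List using (List; []; _∷_; map; _++_; filter)
import Data.List.Properties as LP
open import Data.List.Relation.Unary.All as All using (All; []; _∷_)
import Data.List.Relation.Unary.All.Properties as AllP
open import Data.Nat as ℕ using (zero; suc; z≤n; s≤s; _∸_)
open import Data.Nat.Coprimality using (1-coprimeTo) renaming (sym to coprime-sym)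
open import Data.Nat.ListAction using (sum)
import Data.Nat.Properties as ℕP
open import Data.Product using (_,_)
open import Data.Rational as ℚ using (ℚ; 0ℚ; 1ℚ; ½; mkℚ; _/_)
import Data.Rational.Properties as ℚP
open import Function using (_∘_)
open import Relation.Binary.PropositionalEquality as Eq using (_≢_; refl; cong; cong₂; trans; subst₂)
open import Relation.Nullary using (yes; no; Dec; does)
open import Relation.Unary using (Pred; Decidable)

open import Algebra.Properties.CommutativeSemigroup
  (CommutativeMonoid.commutativeSemigroup ℚP.+-0-commutativeMonoid) using (x∙yz≈y∙xz)
open Eq.≡-Reasoning

ι : ℕ → ℚ
ι m = + m / 1

ι-mkℚ : ∀ m → ι m ≡ mkℚ (+ m) 0 (coprime-sym (1-coprimeTo m))
ι-mkℚ m = ℚP.normalize-coprime (coprime-sym (1-coprimeTo m))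

ι-+ : ∀ m n → ι (m ℕ.+ n) ≡ ι m ℚ.+ ι n
ι-+ m n rewrite ι-mkℚ m | ι-mkℚ n =
  ℚP./-cong {p₁ = + (m ℕ.+ n)} {q₁ = 1} {p₂ = + m ℤ.* + 1 ℤ.+ + n ℤ.* + 1} {q₂ = 1}
    (Eq.sym (cong₂ ℤ._+_ (ℤP.*-identityʳ (+ m)) (ℤP.*-identityʳ (+ n)))) refl

ι-mono-≤ : ∀ {m n} → m ≤ n → ι m ℚ.≤ ι n
ι-mono-≤ {m} {n} m≤n rewrite ι-mkℚ m | ι-mkℚ n =
  ℚ.*≤* (subst₂ ℤ._≤_ (Eq.sym (ℤP.*-identityʳ (+ m))) (Eq.sym (ℤP.*-identityʳ (+ n))) (ℤ.+≤+ m≤n))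

ι-mono-< : ∀ {m n} → m < n → ι m ℚ.< ι n
ι-mono-< {m} {n} m<n rewrite ι-mkℚ m | ι-mkℚ n =
  ℚ.*<* (subst₂ ℤ._<_ (Eq.sym (ℤP.*-identityʳ (+ m))) (Eq.sym (ℤP.*-identityʳ (+ n))) (ℤ.+<+ m<n))

sumUpTo : ℕ → (ℕ → ℚ) → ℚ
sumUpTo zero    f = f 0
sumUpTo (suc m) f = sumUpTo m f ℚ.+ f (suc m)

sumUpTo-cong : ∀ m {f g : ℕ → ℚ} → (∀ k → k ≤ m → f k ≡ g k) → sumUpTo m f ≡ sumUpTo m g
sumUpTo-cong zero    f≡g = f≡g 0 z≤n
sumUpTo-cong (suc m) f≡g =
  cong₂ ℚ._+_ (sumUpTo-cong m (λ k k≤m → f≡g k (ℕP.m≤n⇒m≤1+n k≤m))) (f≡g (suc m) ℕP.≤-refl)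

sumUpTo-zero : ∀ m {f : ℕ → ℚ} → (∀ k → f k ≡ 0ℚ) → sumUpTo m f ≡ 0ℚ
sumUpTo-zero zero    f≡0 = f≡0 0
sumUpTo-zero (suc m) f≡0 rewrite sumUpTo-zero m f≡0 | f≡0 (suc m) = refl

sumUpTo-addAt : ∀ m {j} c {f g : ℕ → ℚ} → j ≤ m →
                (∀ k → k ≤ m → k ≢ j → f k ≡ g k) → f j ≡ c ℚ.+ g j →
                sumUpTo m f ≡ c ℚ.+ sumUpTo m g
sumUpTo-addAt zero _ z≤n _ fj = fj
sumUpTo-addAt (suc m) {j} c {f} {g} j≤1+m f≡g fj with j ℕ.≟ suc m
... | yes refl = begin
  sumUpTo m f ℚ.+ f (suc m)          ≡⟨ cong₂ ℚ._+_ (sumUpTo-cong m f≡g′) fj ⟩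
  sumUpTo m g ℚ.+ (c ℚ.+ g (suc m))  ≡⟨ x∙yz≈y∙xz (sumUpTo m g) c (g (suc m)) ⟩
  c ℚ.+ sumUpTo (suc m) g            ∎
  where
  f≡g′ : ∀ k → k ≤ m → f k ≡ g k
  f≡g′ k k≤m = f≡g k (ℕP.m≤n⇒m≤1+n k≤m) (λ { refl → ℕP.<-irrefl refl (s≤s k≤m) })
... | no j≢1+m = begin
  sumUpTo m f ℚ.+ f (suc m)
    ≡⟨ cong₂ ℚ._+_ (sumUpTo-addAt m c (ℕP.≤-pred (ℕP.≤∧≢⇒< j≤1+m j≢1+m))
                      (λ k k≤m → f≡g k (ℕP.m≤n⇒m≤1+n k≤m)) fj)
                   (f≡g (suc m) ℕP.≤-refl (j≢1+m ∘ Eq.sym)) ⟩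
  (c ℚ.+ sumUpTo m g) ℚ.+ g (suc m)  ≡⟨ ℚP.+-assoc c _ _ ⟩
  c ℚ.+ sumUpTo (suc m) g            ∎

sumUpTo-mono-≤ : ∀ m {f g : ℕ → ℚ} → (∀ k → k ≤ m → f k ℚ.≤ g k) →
                 sumUpTo m f ℚ.≤ sumUpTo m g
sumUpTo-mono-≤ zero    f≤g = f≤g 0 z≤n
sumUpTo-mono-≤ (suc m) f≤g =
  ℚP.+-mono-≤ (sumUpTo-mono-≤ m (λ k k≤m → f≤g k (ℕP.m≤n⇒m≤1+n k≤m))) (f≤g (suc m) ℕP.≤-refl)

sumUpTo-mono-< : ∀ m {f g : ℕ → ℚ} → (∀ k → k ≤ m → f k ℚ.≤ g k) →
                 ∀ {j} → j ≤ m → f j ℚ.< g j → sumUpTo m f ℚ.< sumUpTo m g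
sumUpTo-mono-< zero    f≤g z≤n fj<gj = fj<gj
sumUpTo-mono-< (suc m) f≤g {j} j≤1+m fj<gj with j ℕ.≟ suc m
... | yes refl =
  ℚP.+-mono-≤-< (sumUpTo-mono-≤ m (λ k k≤m → f≤g k (ℕP.m≤n⇒m≤1+n k≤m))) fj<gj
... | no j≢1+m =
  ℚP.+-mono-<-≤ (sumUpTo-mono-< m (λ k k≤m → f≤g k (ℕP.m≤n⇒m≤1+n k≤m))
                                  (ℕP.≤-pred (ℕP.≤∧≢⇒< j≤1+m j≢1+m)) fj<gj)
                (f≤g (suc m) ℕP.≤-refl)

module _ {X : Set} (key : X → ℕ) (F : X → ℕ) where

  keySum : List X → ℕ → ℕ
  keySum L k = sum (map F (filter (λ x → key x ℕ.≟ k) L))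

  keySum-cons-≡ : ∀ x L → keySum (x ∷ L) (key x) ≡ F x ℕ.+ keySum L (key x)
  keySum-cons-≡ x L = cong (sum ∘ map F) (LP.filter-accept (λ y → key y ℕ.≟ key x) refl)

  keySum-cons-≢ : ∀ x L {k} → key x ≢ k → keySum (x ∷ L) k ≡ keySum L k
  keySum-cons-≢ x L {k} kx≢k = cong (sum ∘ map F) (LP.filter-reject (λ y → key y ℕ.≟ k) kx≢k)

  sumℚ-byKey : ∀ m (w : ℕ → ℚ) L → All (λ x → key x ≤ m) L →
               sumℚ (map (λ x → ι (F x) ℚ.* w (key x)) L)
                 ≡ sumUpTo m (λ k → ι (keySum L k) ℚ.* w k)
  sumℚ-byKey m w []       []           = Eq.sym (sumUpTo-zero m (λ k → ℚP.*-zeroˡ (w k)))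
  sumℚ-byKey m w (x ∷ L) (kx≤m ∷ L≤m) = begin
    ι (F x) ℚ.* w (key x) ℚ.+ sumℚ (map (λ x → ι (F x) ℚ.* w (key x)) L)
      ≡⟨ cong (ι (F x) ℚ.* w (key x) ℚ.+_) (sumℚ-byKey m w L L≤m) ⟩
    ι (F x) ℚ.* w (key x) ℚ.+ sumUpTo m (λ k → ι (keySum L k) ℚ.* w k)
      ≡⟨ sumUpTo-addAt m (ι (F x) ℚ.* w (key x)) kx≤m offKey atKey ⟨
    sumUpTo m (λ k → ι (keySum (x ∷ L) k) ℚ.* w k) ∎
    where
    offKey : ∀ k → k ≤ m → k ≢ key x → ι (keySum (x ∷ L) k) ℚ.* w k ≡ ι (keySum L k) ℚ.* w k
    offKey k _ k≢kx = cong (λ n → ι n ℚ.* w k) (keySum-cons-≢ x L (k≢kx ∘ Eq.sym))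

    atKey : ι (keySum (x ∷ L) (key x)) ℚ.* w (key x)
              ≡ ι (F x) ℚ.* w (key x) ℚ.+ ι (keySum L (key x)) ℚ.* w (key x)
    atKey = begin
      ι (keySum (x ∷ L) (key x)) ℚ.* w (key x)
        ≡⟨ cong (λ n → ι n ℚ.* w (key x)) (keySum-cons-≡ x L) ⟩
      ι (F x ℕ.+ keySum L (key x)) ℚ.* w (key x)
        ≡⟨ cong (ℚ._* w (key x)) (ι-+ (F x) _) ⟩
      (ι (F x) ℚ.+ ι (keySum L (key x))) ℚ.* w (key x)
        ≡⟨ ℚP.*-distribʳ-+ (w (key x)) (ι (F x)) _ ⟩
      ι (F x) ℚ.* w (key x) ℚ.+ ι (keySum L (key x)) ℚ.* w (key x) ∎

filter-map : ∀ {a b p} {A : Set a} {B : Set b} {P : Pred B p}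
             (P? : Decidable P) (f : A → B) xs →
             filter P? (map f xs) ≡ map f (filter (P? ∘ f) xs)
filter-map P? f []       = refl
filter-map P? f (x ∷ xs) with does (P? (f x))
... | true  = cong (f x ∷_) (filter-map P? f xs)
... | false = filter-map P? f xs

subsetsOf-∣∣≤ : ∀ {n} (S : Subset n) → All (λ W → ∣ W ∣ ≤ ∣ S ∣) (subsetsOf S)
subsetsOf-∣∣≤ []          = z≤n ∷ []
subsetsOf-∣∣≤ (inside ∷ S) = AllP.++⁺ (AllP.map⁺ (All.map ℕP.m≤n⇒m≤1+n (subsetsOf-∣∣≤ S)))
                                      (AllP.map⁺ (All.map s≤s (subsetsOf-∣∣≤ S)))
subsetsOf-∣∣≤ (outside ∷ S) = AllP.map⁺ (subsetsOf-∣∣≤ S)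

kSubsetsOf-outside : ∀ {n} (S : Subset n) k →
                     kSubsetsOf (outside ∷ S) k ≡ map (outside ∷_) (kSubsetsOf S k)
kSubsetsOf-outside S k = filter-map (λ W → ∣ W ∣ ℕ.≟ k) (outside ∷_) (subsetsOf S)

kSubsetsOf-zero-∷ : ∀ {n} x (S : Subset n) → kSubsetsOf (x ∷ S) 0 ≡ kSubsetsOf (outside ∷ S) 0
kSubsetsOf-zero-∷ outside S = refl
kSubsetsOf-zero-∷ inside  S = begin
  filter empty? (map (outside ∷_) (subsetsOf S) ++ map (inside ∷_) (subsetsOf S))
    ≡⟨ LP.filter-++ empty? (map (outside ∷_) (subsetsOf S)) _ ⟩
  filter empty? (map (outside ∷_) (subsetsOf S)) ++ filter empty? (map (inside ∷_) (subsetsOf S))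
    ≡⟨ cong (filter empty? (map (outside ∷_) (subsetsOf S)) ++_)
            (LP.filter-none empty? (AllP.map⁺ (All.universal (λ _ ()) (subsetsOf S)))) ⟩
  filter empty? (map (outside ∷_) (subsetsOf S)) ++ []
    ≡⟨ LP.++-identityʳ _ ⟩
  filter empty? (map (outside ∷_) (subsetsOf S)) ∎
  where
  empty? : ∀ {m} (W : Subset m) → Dec (∣ W ∣ ≡ 0)
  empty? W = ∣ W ∣ ℕ.≟ 0

kSubsetsOf-zero : ∀ {n} (S : Subset n) → kSubsetsOf S 0 ≡ FS.⊥ ∷ []
kSubsetsOf-zero []      = refl
kSubsetsOf-zero (x ∷ S) = begin
  kSubsetsOf (x ∷ S) 0             ≡⟨ kSubsetsOf-zero-∷ x S ⟩
  kSubsetsOf (outside ∷ S) 0       ≡⟨ kSubsetsOf-outside S 0 ⟩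
  map (outside ∷_) (kSubsetsOf S 0) ≡⟨ cong (map (outside ∷_)) (kSubsetsOf-zero S) ⟩
  FS.⊥ ∷ []                        ∎

*-nonNeg : ∀ {p q} → 0ℚ ℚ.≤ p → 0ℚ ℚ.≤ q → 0ℚ ℚ.≤ p ℚ.* q
*-nonNeg {p} {q} 0≤p 0≤q =
  ℚP.nonNegative⁻¹ _ {{ℚP.nonNeg*nonNeg⇒nonNeg p {{ℚ.nonNegative 0≤p}} q {{ℚ.nonNegative 0≤q}}}}

*-pos : ∀ {p q} → 0ℚ ℚ.< p → 0ℚ ℚ.< q → 0ℚ ℚ.< p ℚ.* q
*-pos {p} {q} 0<p 0<q = ℚP.positive⁻¹ _ {{ℚP.pos*pos⇒pos p {{ℚ.positive 0<p}} q {{ℚ.positive 0<q}}}}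

^ℚ-nonNeg : ∀ {p} m → 0ℚ ℚ.≤ p → 0ℚ ℚ.≤ p ^ℚ m
^ℚ-nonNeg zero    _   = ℚP.nonNegative⁻¹ 1ℚ
^ℚ-nonNeg (suc m) 0≤p = *-nonNeg 0≤p (^ℚ-nonNeg m 0≤p)

^ℚ-pos : ∀ {p} m → 0ℚ ℚ.< p → 0ℚ ℚ.< p ^ℚ m
^ℚ-pos zero    _   = ℚP.positive⁻¹ 1ℚ
^ℚ-pos (suc m) 0<p = *-pos 0<p (^ℚ-pos m 0<p)

p≤1⇒0≤1-p : ∀ {p} → p ℚ.≤ 1ℚ → 0ℚ ℚ.≤ 1ℚ ℚ.- p
p≤1⇒0≤1-p {p} p≤1 = Eq.subst (ℚ._≤ 1ℚ ℚ.- p) (ℚP.+-inverseʳ p) (ℚP.+-monoˡ-≤ (ℚ.- p) p≤1)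

weight : ℕ → ℚ → ℕ → ℚ
weight a q k = q ^ℚ (a ∸ k) ℚ.* (1ℚ ℚ.- q) ^ℚ k

weight-nonNeg : ∀ a {q} k → 0ℚ ℚ.≤ q → q ℚ.≤ 1ℚ → 0ℚ ℚ.≤ weight a q k
weight-nonNeg a k 0≤q q≤1 = *-nonNeg (^ℚ-nonNeg (a ∸ k) 0≤q) (^ℚ-nonNeg k (p≤1⇒0≤1-p q≤1))

weight-½-pos : ∀ a k → 0ℚ ℚ.< weight a ½ k
weight-½-pos a k = *-pos (^ℚ-pos (a ∸ k) (ℚP.positive⁻¹ ½)) (^ℚ-pos k (ℚP.positive⁻¹ (1ℚ ℚ.- ½)))

module _ m {c d : ℕ → ℕ} {w : ℕ → ℚ} (c≤d : ∀ k → k ≤ m → c k ≤ d k) where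

  weightedSum-mono-≤ : (∀ k → 0ℚ ℚ.≤ w k) →
                       sumUpTo m (λ k → ι (c k) ℚ.* w k) ℚ.≤ sumUpTo m (λ k → ι (d k) ℚ.* w k)
  weightedSum-mono-≤ 0≤w = sumUpTo-mono-≤ m λ k k≤m →
    ℚP.*-monoʳ-≤-nonNeg (w k) {{ℚ.nonNegative (0≤w k)}} (ι-mono-≤ (c≤d k k≤m))

  weightedSum-mono-< : (∀ k → 0ℚ ℚ.< w k) → ∀ {j} → j ≤ m → c j < d j →
                       sumUpTo m (λ k → ι (c k) ℚ.* w k) ℚ.< sumUpTo m (λ k → ι (d k) ℚ.* w k)
  weightedSum-mono-< 0<w {j} j≤m cj<dj = sumUpTo-mono-< m
    (λ k k≤m → ℚP.*-monoʳ-≤-nonNeg (w k) {{ℚ.nonNegative (ℚP.<⇒≤ (0<w k))}} (ι-mono-≤ (c≤d k k≤m)))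
    j≤m (ℚP.*-monoˡ-<-pos (w j) {{ℚ.positive (0<w j)}} (ι-mono-< cj<dj))

E-bySize : ∀ {n} (G : Graph n) S q →
           E G S q ≡ sumUpTo ∣ S ∣ (λ k → ι (obsSum G S k) ℚ.* weight ∣ S ∣ q k)
-- keySum ∣_∣ (λ W → ∣ Obs G W ∣) (subsetsOf S) unfolds to obsSum G S.
E-bySize G S q = trans
  (cong sumℚ (LP.map-cong (λ W → ℚP.*-assoc (ι ∣ Obs G W ∣) _ _) (subsetsOf S)))
  (sumℚ-byKey ∣_∣ (λ W → ∣ Obs G W ∣) ∣ S ∣ (weight ∣ S ∣ q) (subsetsOf S) (subsetsOf-∣∣≤ S))

obsSum-zero : ∀ {n} (G : Graph n) S → obsSum G S 0 ≡ ∣ Obs G FS.⊥ ∣ ℕ.+ 0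
obsSum-zero G S = cong (sum ∘ map (λ W → ∣ Obs G W ∣)) (kSubsetsOf-zero S)

proposition4p1 : {n : ℕ} (G : Graph n) (A B : Subset n) → ∣ A ∣ ≡ ∣ B ∣
    → (∀ k → 1 ≤ k → k ≤ ∣ A ∣ → obsSum G A k ≤ obsSum G B k)
    → (E G A ⪯ E G B)
      × ((∃ λ k → 1 ≤ k × k ≤ ∣ A ∣ × obsSum G A k < obsSum G B k) → E G A ≺ E G B)
proposition4p1 G A B ∣A∣≡∣B∣ hyp = E-≤ , E-<
  where
  obsSum-≤ : ∀ k → k ≤ ∣ A ∣ → obsSum G A k ≤ obsSum G B k
  obsSum-≤ zero    _   = ℕP.≤-reflexive (trans (obsSum-zero G A) (Eq.sym (obsSum-zero G B)))
  obsSum-≤ (suc k) 1+k≤a = hyp (suc k) (s≤s z≤n) 1+k≤a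

  E-B : ∀ q → E G B q ≡ sumUpTo ∣ A ∣ (λ k → ι (obsSum G B k) ℚ.* weight ∣ A ∣ q k)
  E-B q rewrite ∣A∣≡∣B∣ = E-bySize G B q

  E-≤ : E G A ⪯ E G B
  E-≤ q 0≤q q≤1 = subst₂ ℚ._≤_ (Eq.sym (E-bySize G A q)) (Eq.sym (E-B q))
    (weightedSum-mono-≤ ∣ A ∣ obsSum-≤ (λ k → weight-nonNeg ∣ A ∣ k 0≤q q≤1))

  E-< : (∃ λ k → 1 ≤ k × k ≤ ∣ A ∣ × obsSum G A k < obsSum G B k) → E G A ≺ E G B
  E-< (k , _ , k≤a , A<B) = E-≤ , λ E≡ → ℚP.<-irrefl (E≡ ½) E½<
    where
    E½< : E G A ½ ℚ.< E G B ½
    E½< = subst₂ ℚ._<_ (Eq.sym (E-bySize G A ½)) (Eq.sym (E-B ½))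
      (weightedSum-mono-< ∣ A ∣ obsSum-≤ (weight-½-pos ∣ A ∣) k≤a A<B)
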